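{- If $H$ and $K$ are thin digraphs, then $\mathbb S(H\boxtimes K)=\mathbb S(H)\,\Box\,\mathbb S(K)$ (as digraphs on the common vertex set $V(H)\times V(K)$).
   Context: All digraphs are finite and simple without loops: $G=(V,E)$ with $E\subseteq\{(x,y)\in V\times V: x\neq y\}$; edges $(x,y)$ are written $xy$. Closed neighborhoods: $N^+[v]=\{x: vx\in E\}\cup\{v\}$, $N^-[v]=\{x: xv\in E\}\cup\{v\}$. A digraph is thin if for all distinct vertices $x,y$, $N^+[x]\neq N^+[y]$ or $N^-[x]\neq N^-[y]$. The strong product $H\boxtimes K$ has vertex set $V(H)\times V(K)$, with $(h,k)(h',k')$ an edge iff (i) $hh'\in E(H)$ and $k=k'$, or (ii) $kk'\in E(K)$ and $h=h'$, or (iii) $hh'\in E(H)$ and $kk'\in E(K)$. The Cartesian product $H\,\Box\,K$ has the same vertex set, with edges only of types (i) and (ii). In what follows $\subset$ denotes proper inclusion. For an edge $xy$ and a vertex $z$ of a digraph $G$: $xy$ satisfies the $N^+$-condition with $z$ if $(1^+)$ $N^+[x]\subset N^+[z]\subset N^+[y]$, or $(2^+)$ $N^+[y]\subset N^+[z]\subset N^+[x]$, or $(3^+)$ $N^+[x]\cap N^+[y]\subset N^+[x]\cap N^+[z]$ and $N^+[x]\cap N^+[y]\subset N^+[y]\cap N^+[z]$; $xy$ satisfies the weak $N^+$-condition with $z$ if $N^+[x]\cap N^+[y]\subseteq N^+[x]\cap N^+[z]$ and $N^+[x]\cap N^+[y]\subseteq N^+[y]\cap N^+[z]$. The conditions $(1^-),(2^-),(3^-)$,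 the $N^-$-condition and the weak $N^-$-condition are defined identically with $N^-$ in place of $N^+$. An edge $xy$ is dispensable if at least one holds: (D1) there is $z$ such that $xy$ satisfies the $N^+$-condition and the $N^-$-condition with $z$; (D2) there are $z_1,z_2$ such that (a) $xy$ satisfies $(3^+)$ with $z_1$ and the weak $N^-$-condition with $z_1$, and (b) $xy$ satisfies $(3^-)$ with $z_2$ and the weak $N^+$-condition with $z_2$; (D3) there is $z$ such that $xy$ satisfies the $N^+$-condition with $z$ and $N^-[x]=N^-[z]$ or $N^-[y]=N^-[z]$; (D4) there is $z$ such that $xy$ satisfies the $N^-$-condition with $z$ and $N^+[x]=N^+[z]$ or $N^+[y]=N^+[z]$; (D5) there are distinct vertices $z_1,z_2$, both distinct from $x$ and $y$, with $N^+[x]=N^+[z_1]$, $N^-[x]=N^-[z_2]$, $N^-[z_1]=N^-[y]$ and $N^+[z_2]=N^+[y]$. The Cartesian skeleton $\mathbb S(G)$ is the digraph with vertex set $V(G)$ and edge set $E(G)$ minus the set of dispensable edges. -}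

module Defs where

open import Level using (0ℓ)
open import Data.Nat using (ℕ)
open import Data.Fin using (Fin)
open import Data.Product using (Σ; ∃; ∃₂; _×_; _,_)
open import Data.Sum using (_⊎_)
open import Relation.Nullary using (¬_)
open import Relation.Unary using (Pred; _⊆_; _⊂_; _≐_; _∩_)
open import Relation.Binary.PropositionalEquality using (_≡_; _≢_)

Rel : Set → Set₁
Rel V = V → V → Set

-- A finite simple digraph on vertex set Fin n: an edge relation without loops.
-- (Edges of a finite digraph form a finite set, so membership is decidable;
--  we record this as a field.)
record Digraph (n : ℕ) : Set₁ where
  field
    _⇒_      : Rel (Fin n)
    loopless : ∀ x → ¬ (x ⇒ x)
    decEdge  : ∀ x y → (x ⇒ y) ⊎ ¬ (x ⇒ y)
open Digraph public

module _ {V : Set} (E : Rel V) where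

  N⁺ : V → Pred V 0ℓ
  N⁺ v x = E v x ⊎ x ≡ v

  N⁻ : V → Pred V 0ℓ
  N⁻ v x = E x v ⊎ x ≡ v

module _ {V : Set} where

  Cond1 : (V → Pred V 0ℓ) → V → V → V → Set
  Cond1 N x y z = (N x ⊂ N z) × (N z ⊂ N y)

  Cond2 : (V → Pred V 0ℓ) → V → V → V → Set
  Cond2 N x y z = (N y ⊂ N z) × (N z ⊂ N x)

  Cond3 : (V → Pred V 0ℓ) → V → V → V → Set
  Cond3 N x y z = ((N x ∩ N y) ⊂ (N x ∩ N z)) × ((N x ∩ N y) ⊂ (N y ∩ N z))

  NCond : (V → Pred V 0ℓ) → V → V → V → Set
  NCond N x y z = Cond1 N x y z ⊎ Cond2 N x y z ⊎ Cond3 N x y z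

  WeakCond : (V → Pred V 0ℓ) → V → V → V → Set
  WeakCond N x y z = ((N x ∩ N y) ⊆ (N x ∩ N z)) × ((N x ∩ N y) ⊆ (N y ∩ N z))

  module _ (E : Rel V) where

    D1 : V → V → Set
    D1 x y = ∃ λ z → NCond (N⁺ E) x y z × NCond (N⁻ E) x y z

    D2 : V → V → Set
    D2 x y = ∃₂ λ z₁ z₂ →
      (Cond3 (N⁺ E) x y z₁ × WeakCond (N⁻ E) x y z₁)
      × (Cond3 (N⁻ E) x y z₂ × WeakCond (N⁺ E) x y z₂)

    D3 : V → V → Set
    D3 x y = ∃ λ z → NCond (N⁺ E) x y z × ((N⁻ E x ≐ N⁻ E z) ⊎ (N⁻ E y ≐ N⁻ E z))

    D4 : V → V → Set
    D4 x y = ∃ λ z → NCond (N⁻ E) x y z × ((N⁺ E x ≐ N⁺ E z) ⊎ (N⁺ E y ≐ N⁺ E z))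

    D5 : V → V → Set
    D5 x y = ∃₂ λ z₁ z₂ →
      z₁ ≢ z₂ × z₁ ≢ x × z₁ ≢ y × z₂ ≢ x × z₂ ≢ y
      × (N⁺ E x ≐ N⁺ E z₁) × (N⁻ E x ≐ N⁻ E z₂)
      × (N⁻ E z₁ ≐ N⁻ E y) × (N⁺ E z₂ ≐ N⁺ E y)

    -- an edge xy is dispensable (only meaningful when E x y holds)
    Dispensable : V → V → Set
    Dispensable x y = D1 x y ⊎ D2 x y ⊎ D3 x y ⊎ D4 x y ⊎ D5 x y

    Skel : Rel V
    Skel x y = E x y × ¬ Dispensable x y

    Thin : Set
    Thin = ∀ x y → x ≢ y → ¬ ((N⁺ E x ≐ N⁺ E y) × (N⁻ E x ≐ N⁻ E y))

_⊠_ : {A B : Set} → Rel A → Rel B → Rel (A × B)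
(EH ⊠ EK) (h , k) (h' , k') =
  (EH h h' × k ≡ k') ⊎ (EK k k' × h ≡ h') ⊎ (EH h h' × EK k k')

_□_ : {A B : Set} → Rel A → Rel B → Rel (A × B)
(EH □ EK) (h , k) (h' , k') = (EH h h' × k ≡ k') ⊎ (EK k k' × h ≡ h')

_≅ᴱ_ : {V : Set} → Rel V → Rel V → Set
E ≅ᴱ F = ∀ u v → (E u v → F u v) × (F u v → E u v)

-- Closed neighbourhoods in H ⊠ K are boxes, N[(h,k)] = N[h] × N[k], so every condition in
-- the definition of dispensability is an inclusion between boxes or intersections of boxes.
-- For an edge (h,k)(h′,k) inside a fibre, these inclusions with any witness (c,d) project to
-- inclusions in H with witness c, and conversely lift along c ↦ (c,k); in D5 the witnesses
-- must stay in the fibre, which is where thinness of K is used. An edge (h,k)(h′,k′) moving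
-- in both coordinates is always dispensable, witnessed by the corners (h,k′) and (h′,k):
-- comparing N[h] with N[h′] and N[k] with N[k′] shows that, for each of N⁺ and N⁻, either
-- condition 3 holds at a corner, or conditions 1/2 hold at both corners, or one coordinate
-- has equal neighbourhoods. Each combination of an N⁺ case with an N⁻ case yields one of
-- D1–D5, except equality in the same coordinate for both, which thinness rules out.

module Submission where

open import Defs
open import Level using (0ℓ)
open import Data.Bool using (Bool; true; false)
open import Data.Empty using (⊥-elim)
open import Data.Fin using (Fin; _≟_)
open import Data.Fin.Properties using (all?)
open import Data.Product using (∃; ∃₂; _×_; _,_; proj₁; proj₂; swap)
open import Data.Sum using (_⊎_; inj₁; inj₂)
import Data.Sum as Sum
open import Function using (_∘_; id; _⇔_; mk⇔; Equivalence)
open import Relation.Binary.Definitions using (Reflexive; DecidableEquality)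
open import Relation.Binary.PropositionalEquality using (_≡_; _≢_; refl; sym; trans; cong; cong₂)
import Relation.Binary.PropositionalEquality as ≡
open import Relation.Nullary using (¬_; Dec; yes; no)
open import Relation.Nullary.Decidable using (map′; fromSum; decidable-stable; _⊎-dec_; _→-dec_)
open import Relation.Unary using (Pred; Decidable; _⊆_; _⊂_; _≐_; _∩_)
open import Relation.Unary.Properties using (≐-sym)

open Equivalence using (to; from)

-- Dispensability only looks at the two closed-neighbourhood maps:
-- Dispensable E is definitionally Dispensableᴺ (N⁺ E) (N⁻ E).
module _ {V : Set} (N⁺ N⁻ : V → Pred V 0ℓ) where

  Dispensableᴺ : V → V → Set
  Dispensableᴺ x y =
      (∃ λ z → NCond N⁺ x y z × NCond N⁻ x y z)
    ⊎ (∃₂ λ z₁ z₂ → (Cond3 N⁺ x y z₁ × WeakCond N⁻ x y z₁)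
                  × (Cond3 N⁻ x y z₂ × WeakCond N⁺ x y z₂))
    ⊎ (∃ λ z → NCond N⁺ x y z × ((N⁻ x ≐ N⁻ z) ⊎ (N⁻ y ≐ N⁻ z)))
    ⊎ (∃ λ z → NCond N⁻ x y z × ((N⁺ x ≐ N⁺ z) ⊎ (N⁺ y ≐ N⁺ z)))
    ⊎ (∃₂ λ z₁ z₂ →
        z₁ ≢ z₂ × z₁ ≢ x × z₁ ≢ y × z₂ ≢ x × z₂ ≢ y
        × (N⁺ x ≐ N⁺ z₁) × (N⁻ x ≐ N⁻ z₂)
        × (N⁻ z₁ ≐ N⁻ y) × (N⁺ z₂ ≐ N⁺ y))

pattern cond₁ c = inj₁ c
pattern cond₂ c = inj₂ (inj₁ c)
pattern cond₃ c = inj₂ (inj₂ c)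

pattern disp₁ z c⁺ c⁻ = inj₁ (z , c⁺ , c⁻)
pattern disp₂ z₁ z₂ c⁺ w⁻ c⁻ w⁺ = inj₂ (inj₁ (z₁ , z₂ , (c⁺ , w⁻) , (c⁻ , w⁺)))
pattern disp₃ z c e = inj₂ (inj₂ (inj₁ (z , c , e)))
pattern disp₄ z c e = inj₂ (inj₂ (inj₂ (inj₁ (z , c , e))))
pattern disp₅ z₁ z₂ d₁₂ d₁x d₁y d₂x d₂y e₁ e₂ e₃ e₄ =
  inj₂ (inj₂ (inj₂ (inj₂ (z₁ , z₂ , d₁₂ , d₁x , d₁y , d₂x , d₂y , e₁ , e₂ , e₃ , e₄))))

Distinguishing : {U : Set} → (U → Pred U 0ℓ) → (U → Pred U 0ℓ) → Set
Distinguishing Q⁺ Q⁻ = ∀ {u u′} → Q⁺ u ≐ Q⁺ u′ → Q⁻ u ≐ Q⁻ u′ → u ≡ u′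

module Relabelling {W W′ : Set} (σ : W → W′) (τ : W′ → W) (τ∘σ : ∀ w → τ (σ w) ≡ w) where

  σ-injective : ∀ {a b} → σ a ≡ σ b → a ≡ b
  σ-injective {a} {b} eq = trans (sym (τ∘σ a)) (trans (cong τ eq) (τ∘σ b))

  module _ {A B : Pred W 0ℓ} {A′ B′ : Pred W′ 0ℓ} where

    ∩-pullback : A′ ≐ A ∘ τ → B′ ≐ B ∘ τ → (A′ ∩ B′) ≐ (A ∩ B) ∘ τ
    ∩-pullback (A′⊆A , A⊆A′) (B′⊆B , B⊆B′) =
      (λ (a , b) → A′⊆A a , B′⊆B b) , (λ (a , b) → A⊆A′ a , B⊆B′ b)

    ⊆-transport : A′ ≐ A ∘ τ → B′ ≐ B ∘ τ → A ⊆ B → A′ ⊆ B′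
    ⊆-transport (A′⊆A , _) (_ , B⊆B′) A⊆B a = B⊆B′ (A⊆B (A′⊆A a))

    ⊆-reflect : A′ ≐ A ∘ τ → B′ ≐ B ∘ τ → A′ ⊆ B′ → A ⊆ B
    ⊆-reflect (_ , A⊆A′) (B′⊆B , _) A′⊆B′ {w} a =
      ≡.subst B (τ∘σ w) (B′⊆B (A′⊆B′ (A⊆A′ (≡.subst A (sym (τ∘σ w)) a))))

  ⊂-transport : {A B : Pred W 0ℓ} {A′ B′ : Pred W′ 0ℓ} →
                A′ ≐ A ∘ τ → B′ ≐ B ∘ τ → A ⊂ B → A′ ⊂ B′
  ⊂-transport {A} {B} {A′} {B′} eA eB (A⊆B , B⊈A) =
    ⊆-transport {A} {B} {A′} {B′} eA eB A⊆B , B⊈A ∘ ⊆-reflect {B} {A} {B′} {A′} eB eA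

  ≐-transport : {A B : Pred W 0ℓ} {A′ B′ : Pred W′ 0ℓ} →
                A′ ≐ A ∘ τ → B′ ≐ B ∘ τ → A ≐ B → A′ ≐ B′
  ≐-transport {A} {B} {A′} {B′} eA eB (A⊆B , B⊆A) =
    ⊆-transport {A} {B} {A′} {B′} eA eB A⊆B , ⊆-transport {B} {A} {B′} {A′} eB eA B⊆A

  module Conditions {N : W → Pred W 0ℓ} {N′ : W′ → Pred W′ 0ℓ}
                    (pull : ∀ a → N′ (σ a) ≐ N a ∘ τ) where

    private
      pull∩ : ∀ a b → (N′ (σ a) ∩ N′ (σ b)) ≐ (N a ∩ N b) ∘ τ
      pull∩ a b = ∩-pullback {N a} {N b} (pull a) (pull b)

    Cond1-transport : ∀ {x y z} → Cond1 N x y z → Cond1 N′ (σ x) (σ y) (σ z)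
    Cond1-transport (xz , zy) = ⊂-transport (pull _) (pull _) xz , ⊂-transport (pull _) (pull _) zy

    Cond3-transport : ∀ {x y z} → Cond3 N x y z → Cond3 N′ (σ x) (σ y) (σ z)
    Cond3-transport (l , r) =
      ⊂-transport (pull∩ _ _) (pull∩ _ _) l , ⊂-transport (pull∩ _ _) (pull∩ _ _) r

    WeakCond-transport : ∀ {x y z} → WeakCond N x y z → WeakCond N′ (σ x) (σ y) (σ z)
    WeakCond-transport {x} {y} {z} (l , r) =
      ⊆-transport {N x ∩ N y} (pull∩ x y) (pull∩ x z) l ,
      ⊆-transport {N x ∩ N y} (pull∩ x y) (pull∩ y z) r

    NCond-transport : ∀ {x y z} → NCond N x y z → NCond N′ (σ x) (σ y) (σ z)
    NCond-transport (cond₁ c) = cond₁ (Cond1-transport c)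
    NCond-transport (cond₂ c) = cond₂ (Cond1-transport c)
    NCond-transport (cond₃ c) = cond₃ (Cond3-transport c)

    N-≐-transport : ∀ {a b} → N a ≐ N b → N′ (σ a) ≐ N′ (σ b)
    N-≐-transport = ≐-transport (pull _) (pull _)

  module _ {N⁺ N⁻ : W → Pred W 0ℓ} {N′⁺ N′⁻ : W′ → Pred W′ 0ℓ}
           (pull⁺ : ∀ a → N′⁺ (σ a) ≐ N⁺ a ∘ τ) (pull⁻ : ∀ a → N′⁻ (σ a) ≐ N⁻ a ∘ τ) where

    private
      module T⁺ = Conditions {N⁺} {N′⁺} pull⁺
      module T⁻ = Conditions {N⁻} {N′⁻} pull⁻

    Dispensableᴺ-transport : ∀ {x y} → Dispensableᴺ N⁺ N⁻ x y → Dispensableᴺ N′⁺ N′⁻ (σ x) (σ y)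
    Dispensableᴺ-transport (disp₁ z c⁺ c⁻) =
      disp₁ (σ z) (T⁺.NCond-transport c⁺) (T⁻.NCond-transport c⁻)
    Dispensableᴺ-transport (disp₂ z₁ z₂ c⁺ w⁻ c⁻ w⁺) =
      disp₂ (σ z₁) (σ z₂) (T⁺.Cond3-transport c⁺) (T⁻.WeakCond-transport w⁻)
                          (T⁻.Cond3-transport c⁻) (T⁺.WeakCond-transport w⁺)
    Dispensableᴺ-transport (disp₃ z c e) =
      disp₃ (σ z) (T⁺.NCond-transport c) (Sum.map T⁻.N-≐-transport T⁻.N-≐-transport e)
    Dispensableᴺ-transport (disp₄ z c e) =
      disp₄ (σ z) (T⁻.NCond-transport c) (Sum.map T⁺.N-≐-transport T⁺.N-≐-transport e)
    Dispensableᴺ-transport (disp₅ z₁ z₂ d₁₂ d₁x d₁y d₂x d₂y e₁ e₂ e₃ e₄) =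
      disp₅ (σ z₁) (σ z₂)
        (d₁₂ ∘ σ-injective) (d₁x ∘ σ-injective) (d₁y ∘ σ-injective)
        (d₂x ∘ σ-injective) (d₂y ∘ σ-injective)
        (T⁺.N-≐-transport e₁) (T⁻.N-≐-transport e₂) (T⁻.N-≐-transport e₃) (T⁺.N-≐-transport e₄)

_⊗_ : {V U : Set} → (V → Pred V 0ℓ) → (U → Pred U 0ℓ) → V × U → Pred (V × U) 0ℓ
(P ⊗ Q) (a , b) (a′ , b′) = P a a′ × Q b b′

module ⊗-Properties {V U : Set} (P : V → Pred V 0ℓ) (Q : U → Pred U 0ℓ) where

  ⊗-mono : ∀ {a b c d} → P a ⊆ P c → Q b ⊆ Q d → (P ⊗ Q) (a , b) ⊆ (P ⊗ Q) (c , d)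
  ⊗-mono P⊆ Q⊆ (p , q) = P⊆ p , Q⊆ q

  ⊗-⊆-proj₁ : Reflexive Q → ∀ {a b c d} → (P ⊗ Q) (a , b) ⊆ (P ⊗ Q) (c , d) → P a ⊆ P c
  ⊗-⊆-proj₁ Q-refl ⊆ p = proj₁ (⊆ (p , Q-refl))

  ⊗-⊆-proj₂ : Reflexive P → ∀ {a b c d} → (P ⊗ Q) (a , b) ⊆ (P ⊗ Q) (c , d) → Q b ⊆ Q d
  ⊗-⊆-proj₂ P-refl ⊆ q = proj₂ (⊆ (P-refl , q))

  ⊗-⊂ˡ : Reflexive Q → ∀ {a b c} → P a ⊂ P c → (P ⊗ Q) (a , b) ⊂ (P ⊗ Q) (c , b)
  ⊗-⊂ˡ Q-refl (⊆ , ⊈) = ⊗-mono ⊆ (λ q → q) , ⊈ ∘ ⊗-⊆-proj₁ Q-refl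

  ⊗-⊂ʳ : Reflexive P → ∀ {a b d} → Q b ⊂ Q d → (P ⊗ Q) (a , b) ⊂ (P ⊗ Q) (a , d)
  ⊗-⊂ʳ P-refl (⊆ , ⊈) = ⊗-mono (λ p → p) ⊆ , ⊈ ∘ ⊗-⊆-proj₂ P-refl

  ⊗-≐ˡ : ∀ {a b c} → P a ≐ P c → (P ⊗ Q) (a , b) ≐ (P ⊗ Q) (c , b)
  ⊗-≐ˡ (⊆ , ⊇) = ⊗-mono ⊆ (λ q → q) , ⊗-mono ⊇ (λ q → q)

  ⊗-≐ʳ : ∀ {a b d} → Q b ≐ Q d → (P ⊗ Q) (a , b) ≐ (P ⊗ Q) (a , d)
  ⊗-≐ʳ (⊆ , ⊇) = ⊗-mono (λ p → p) ⊆ , ⊗-mono (λ p → p) ⊇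

  ⊗-swap : ∀ a b → (Q ⊗ P) (b , a) ≐ (P ⊗ Q) (a , b) ∘ swap
  ⊗-swap a b = swap , swap

Dispensableᴺ-⊗-comm : {V U : Set} {P⁺ P⁻ : V → Pred V 0ℓ} {Q⁺ Q⁻ : U → Pred U 0ℓ} →
  ∀ {a a′ b b′} → Dispensableᴺ (P⁺ ⊗ Q⁺) (P⁻ ⊗ Q⁻) (a , b) (a′ , b′) →
  Dispensableᴺ (Q⁺ ⊗ P⁺) (Q⁻ ⊗ P⁻) (b , a) (b′ , a′)
Dispensableᴺ-⊗-comm {P⁺ = P⁺} {P⁻} {Q⁺} {Q⁻} =
  Dispensableᴺ-transport (λ (a , b) → ⊗-Properties.⊗-swap P⁺ Q⁺ a b)
                         (λ (a , b) → ⊗-Properties.⊗-swap P⁻ Q⁻ a b)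
  where open Relabelling swap swap (λ _ → refl)

module Fibre {V U : Set} {P : V → Pred V 0ℓ} {Q : U → Pred U 0ℓ}
             (P-refl : Reflexive P) (Q-refl : Reflexive Q) where

  open ⊗-Properties P Q public

  private
    n = P ⊗ Q

  ⊂-proj₁ : ∀ {a b c d} → Q b ≐ Q d → n (a , b) ⊂ n (c , d) → P a ⊂ P c
  ⊂-proj₁ (_ , d⊆b) (⊆ , ⊈) = ⊗-⊆-proj₁ Q-refl ⊆ , λ c⊆a → ⊈ (⊗-mono c⊆a d⊆b)

  ≐-proj₁ : ∀ {a b c d} → n (a , b) ≐ n (c , d) → P a ≐ P c
  ≐-proj₁ (⊆ , ⊇) = ⊗-⊆-proj₁ Q-refl ⊆ , ⊗-⊆-proj₁ Q-refl ⊇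

  ≐-proj₂ : ∀ {a b c d} → n (a , b) ≐ n (c , d) → Q b ≐ Q d
  ≐-proj₂ (⊆ , ⊇) = ⊗-⊆-proj₂ P-refl ⊆ , ⊗-⊆-proj₂ P-refl ⊇

  ∩⊆-proj₁ : ∀ {a a′ b c c′ d d′} → (n (a , b) ∩ n (a′ , b)) ⊆ (n (c , d) ∩ n (c′ , d′)) →
             (P a ∩ P a′) ⊆ (P c ∩ P c′)
  ∩⊆-proj₁ ⊆ (p , p′) with ⊆ ((p , Q-refl) , (p′ , Q-refl))
  ... | (pc , _) , (pc′ , _) = pc , pc′

  ∩⊆-lift : ∀ {a a′ b c c′} → (P a ∩ P a′) ⊆ (P c ∩ P c′) →
            (n (a , b) ∩ n (a′ , b)) ⊆ (n (c , b) ∩ n (c′ , b))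
  ∩⊆-lift ⊆ ((p , q) , (p′ , _)) with ⊆ (p , p′)
  ... | pc , pc′ = (pc , q) , (pc′ , q)

  -- General enough for both halves of Cond3, whose right-hand sides start with x and with y.
  ∩⊂-proj₁ : ∀ {a a′ b c c′ d} → (n (a , b) ∩ n (a′ , b)) ⊂ (n (c , b) ∩ n (c′ , d)) →
             (P a ∩ P a′) ⊂ (P c ∩ P c′)
  ∩⊂-proj₁ (⊆ , ⊈) = ∩⊆-proj₁ ⊆ , λ ⊇ → ⊈ λ ((pc , q) , (pc′ , _)) →
    let p , p′ = ⊇ (pc , pc′) in (p , q) , (p′ , q)

  ∩⊂-lift : ∀ {a a′ b c c′} → (P a ∩ P a′) ⊂ (P c ∩ P c′) →
            (n (a , b) ∩ n (a′ , b)) ⊂ (n (c , b) ∩ n (c′ , b))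
  ∩⊂-lift (⊆ , ⊈) = ∩⊆-lift ⊆ , ⊈ ∘ ∩⊆-proj₁

  Cond1-proj : ∀ {a a′ b c d} → Cond1 n (a , b) (a′ , b) (c , d) → Cond1 P a a′ c
  Cond1-proj {b = b} {d = d} (xz , zy) = ⊂-proj₁ b≐d xz , ⊂-proj₁ (≐-sym b≐d) zy
    where
      b≐d : Q b ≐ Q d
      b≐d = ⊗-⊆-proj₂ P-refl (proj₁ xz) , ⊗-⊆-proj₂ P-refl (proj₁ zy)

  Cond1-lift : ∀ {a a′ b c} → Cond1 P a a′ c → Cond1 n (a , b) (a′ , b) (c , b)
  Cond1-lift (ac , ca′) = ⊗-⊂ˡ Q-refl ac , ⊗-⊂ˡ Q-refl ca′

  Cond3-proj : ∀ {a a′ b c d} → Cond3 n (a , b) (a′ , b) (c , d) → Cond3 P a a′ c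
  Cond3-proj (l , r) = ∩⊂-proj₁ l , ∩⊂-proj₁ r

  Cond3-lift : ∀ {a a′ b c} → Cond3 P a a′ c → Cond3 n (a , b) (a′ , b) (c , b)
  Cond3-lift (l , r) = ∩⊂-lift l , ∩⊂-lift r

  WeakCond-proj : ∀ {a a′ b c d} → WeakCond n (a , b) (a′ , b) (c , d) → WeakCond P a a′ c
  WeakCond-proj (l , r) = ∩⊆-proj₁ l , ∩⊆-proj₁ r

  WeakCond-lift : ∀ {a a′ b c} → WeakCond P a a′ c → WeakCond n (a , b) (a′ , b) (c , b)
  WeakCond-lift (l , r) = ∩⊆-lift l , ∩⊆-lift r

  NCond-proj : ∀ {a a′ b c d} → NCond n (a , b) (a′ , b) (c , d) → NCond P a a′ c
  NCond-proj (cond₁ c) = cond₁ (Cond1-proj c)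
  NCond-proj (cond₂ c) = cond₂ (Cond1-proj c)
  NCond-proj (cond₃ c) = cond₃ (Cond3-proj c)

  NCond-lift : ∀ {a a′ b c} → NCond P a a′ c → NCond n (a , b) (a′ , b) (c , b)
  NCond-lift (cond₁ c) = cond₁ (Cond1-lift c)
  NCond-lift (cond₂ c) = cond₂ (Cond1-lift c)
  NCond-lift (cond₃ c) = cond₃ (Cond3-lift c)

module Axis {V U : Set} (P⁺ P⁻ : V → Pred V 0ℓ) (Q⁺ Q⁻ : U → Pred U 0ℓ)
            (P⁺-refl : Reflexive P⁺) (P⁻-refl : Reflexive P⁻)
            (Q⁺-refl : Reflexive Q⁺) (Q⁻-refl : Reflexive Q⁻) where

  private
    module F⁺ = Fibre {P = P⁺} {Q⁺} P⁺-refl Q⁺-refl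
    module F⁻ = Fibre {P = P⁻} {Q⁻} P⁻-refl Q⁻-refl

  Dispensableᴺ-lift : ∀ {a a′ b} → Dispensableᴺ P⁺ P⁻ a a′ →
                      Dispensableᴺ (P⁺ ⊗ Q⁺) (P⁻ ⊗ Q⁻) (a , b) (a′ , b)
  Dispensableᴺ-lift {b = b} (disp₁ z c⁺ c⁻) = disp₁ (z , b) (F⁺.NCond-lift c⁺) (F⁻.NCond-lift c⁻)
  Dispensableᴺ-lift {b = b} (disp₂ z₁ z₂ c⁺ w⁻ c⁻ w⁺) =
    disp₂ (z₁ , b) (z₂ , b) (F⁺.Cond3-lift c⁺) (F⁻.WeakCond-lift w⁻)
                            (F⁻.Cond3-lift c⁻) (F⁺.WeakCond-lift w⁺)
  Dispensableᴺ-lift {b = b} (disp₃ z c e) =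
    disp₃ (z , b) (F⁺.NCond-lift c) (Sum.map F⁻.⊗-≐ˡ F⁻.⊗-≐ˡ e)
  Dispensableᴺ-lift {b = b} (disp₄ z c e) =
    disp₄ (z , b) (F⁻.NCond-lift c) (Sum.map F⁺.⊗-≐ˡ F⁺.⊗-≐ˡ e)
  Dispensableᴺ-lift {b = b} (disp₅ z₁ z₂ d₁₂ d₁x d₁y d₂x d₂y e₁ e₂ e₃ e₄) =
    disp₅ (z₁ , b) (z₂ , b)
      (d₁₂ ∘ cong proj₁) (d₁x ∘ cong proj₁) (d₁y ∘ cong proj₁) (d₂x ∘ cong proj₁) (d₂y ∘ cong proj₁)
      (F⁺.⊗-≐ˡ e₁) (F⁻.⊗-≐ˡ e₂) (F⁻.⊗-≐ˡ e₃) (F⁺.⊗-≐ˡ e₄)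

  Dispensableᴺ-proj : Distinguishing Q⁺ Q⁻ → ∀ {a a′ b} →
                      Dispensableᴺ (P⁺ ⊗ Q⁺) (P⁻ ⊗ Q⁻) (a , b) (a′ , b) → Dispensableᴺ P⁺ P⁻ a a′
  Dispensableᴺ-proj _ (disp₁ (c , _) c⁺ c⁻) = disp₁ c (F⁺.NCond-proj c⁺) (F⁻.NCond-proj c⁻)
  Dispensableᴺ-proj _ (disp₂ (c₁ , _) (c₂ , _) c⁺ w⁻ c⁻ w⁺) =
    disp₂ c₁ c₂ (F⁺.Cond3-proj c⁺) (F⁻.WeakCond-proj w⁻) (F⁻.Cond3-proj c⁻) (F⁺.WeakCond-proj w⁺)
  Dispensableᴺ-proj _ (disp₃ (c , _) k e) =
    disp₃ c (F⁺.NCond-proj k) (Sum.map F⁻.≐-proj₁ F⁻.≐-proj₁ e)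
  Dispensableᴺ-proj _ (disp₄ (c , _) k e) =
    disp₄ c (F⁻.NCond-proj k) (Sum.map F⁺.≐-proj₁ F⁺.≐-proj₁ e)
  Dispensableᴺ-proj distinguishing {b = b}
    (disp₅ (c₁ , d₁) (c₂ , d₂) d₁₂ d₁x d₁y d₂x d₂y e₁ e₂ e₃ e₄) =
    disp₅ c₁ c₂
      (λ eq → d₁₂ (cong₂ _,_ eq (trans d₁≡b (sym d₂≡b))))
      (λ eq → d₁x (cong₂ _,_ eq d₁≡b)) (λ eq → d₁y (cong₂ _,_ eq d₁≡b))
      (λ eq → d₂x (cong₂ _,_ eq d₂≡b)) (λ eq → d₂y (cong₂ _,_ eq d₂≡b))
      (F⁺.≐-proj₁ e₁) (F⁻.≐-proj₁ e₂) (F⁻.≐-proj₁ e₃) (F⁺.≐-proj₁ e₄)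
    where
      -- Distinguishability puts both witnesses into the fibre over b.
      d₁≡b : d₁ ≡ b
      d₁≡b = distinguishing (≐-sym (F⁺.≐-proj₂ e₁)) (F⁻.≐-proj₂ e₃)
      d₂≡b : d₂ ≡ b
      d₂≡b = distinguishing (F⁺.≐-proj₂ e₄) (≐-sym (F⁻.≐-proj₂ e₂))

module Square {V U : Set} (a a′ : V) (b b′ : U) where

  corner : Bool → V × U
  corner true  = a , b′
  corner false = a′ , b

  module Side {P : V → Pred V 0ℓ} {Q : U → Pred U 0ℓ} (P-refl : Reflexive P) (Q-refl : Reflexive Q)
              {p₀ : V} (p₀∈a : P a p₀) (p₀∈a′ : P a′ p₀)
              {q₀ : U} (q₀∈b : Q b q₀) (q₀∈b′ : Q b′ q₀) where

    open ⊗-Properties P Q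

    private
      n = P ⊗ Q
      x = (a , b)
      y = (a′ , b′)

    WeakCond-corner : ∀ c → WeakCond n x y (corner c)
    WeakCond-corner true  = (λ ((p , q) , (_ , q′)) → (p , q) , (p , q′))
                          , (λ ((p , _) , (p′ , q′)) → (p′ , q′) , (p , q′))
    WeakCond-corner false = (λ ((p , q) , (p′ , _)) → (p , q) , (p′ , q))
                          , (λ ((_ , q) , (p′ , q′)) → (p′ , q′) , (p′ , q))

    Cond3-corner-true : ¬ (P a ⊆ P a′) → ¬ (Q b′ ⊆ Q b) → Cond3 n x y (corner true)
    Cond3-corner-true a⊈a′ b′⊈b =
      (proj₁ (WeakCond-corner true) , λ ⊆ → a⊈a′ λ p →
         proj₁ (proj₂ (⊆ ((p , q₀∈b) , (p , q₀∈b′))))) ,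
      (proj₂ (WeakCond-corner true) , λ ⊆ → b′⊈b λ q →
         proj₂ (proj₁ (⊆ ((p₀∈a′ , q) , (p₀∈a , q)))))

    Cond3-corner-false : ¬ (P a′ ⊆ P a) → ¬ (Q b ⊆ Q b′) → Cond3 n x y (corner false)
    Cond3-corner-false a′⊈a b⊈b′ =
      (proj₁ (WeakCond-corner false) , λ ⊆ → b⊈b′ λ q →
         proj₂ (proj₂ (⊆ ((p₀∈a , q) , (p₀∈a′ , q))))) ,
      (proj₂ (WeakCond-corner false) , λ ⊆ → a′⊈a λ p →
         proj₁ (proj₁ (⊆ ((p , q₀∈b′) , (p , q₀∈b)))))

    Cond1-corner : P a ⊂ P a′ → Q b ⊂ Q b′ → ∀ c → Cond1 n x y (corner c)
    Cond1-corner a⊂a′ b⊂b′ true  = ⊗-⊂ʳ P-refl b⊂b′ , ⊗-⊂ˡ Q-refl a⊂a′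
    Cond1-corner a⊂a′ b⊂b′ false = ⊗-⊂ˡ Q-refl a⊂a′ , ⊗-⊂ʳ P-refl b⊂b′

    Cond2-corner : P a′ ⊂ P a → Q b′ ⊂ Q b → ∀ c → Cond2 n x y (corner c)
    Cond2-corner a′⊂a b′⊂b true  = ⊗-⊂ˡ Q-refl a′⊂a , ⊗-⊂ʳ P-refl b′⊂b
    Cond2-corner a′⊂a b′⊂b false = ⊗-⊂ʳ P-refl b′⊂b , ⊗-⊂ˡ Q-refl a′⊂a

    ≐-corners₁ : P a ≐ P a′ → (n x ≐ n (corner false)) × (n (corner true) ≐ n y)
    ≐-corners₁ e = ⊗-≐ˡ e , ⊗-≐ˡ e

    ≐-corners₂ : Q b ≐ Q b′ → (n x ≐ n (corner true)) × (n (corner false) ≐ n y)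
    ≐-corners₂ e = ⊗-≐ʳ e , ⊗-≐ʳ e

    Flat : Set
    Flat = (P a ≐ P a′) ⊎ (Q b ≐ Q b′)

    Flat⇒≐-corner : Flat → ∀ c → (n x ≐ n (corner c)) ⊎ (n y ≐ n (corner c))
    Flat⇒≐-corner (inj₁ e) true  = inj₂ (≐-sym (proj₂ (≐-corners₁ e)))
    Flat⇒≐-corner (inj₁ e) false = inj₁ (proj₁ (≐-corners₁ e))
    Flat⇒≐-corner (inj₂ e) true  = inj₁ (proj₁ (≐-corners₂ e))
    Flat⇒≐-corner (inj₂ e) false = inj₂ (≐-sym (proj₂ (≐-corners₂ e)))

    data Shape : Set where
      crossed : ∀ c → Cond3 n x y (corner c) → Shape
      nested  : (∀ c → NCond n x y (corner c)) → Shape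
      flat    : Flat → Shape

    -- Unless one coordinate is flat, the two coordinates are either compared in
    -- opposite directions somewhere (crossed) or strictly in the same direction (nested).
    shape : Dec (P a ⊆ P a′) → Dec (P a′ ⊆ P a) → Dec (Q b ⊆ Q b′) → Dec (Q b′ ⊆ Q b) → Shape
    shape (yes s) (yes t) _ _ = flat (inj₁ (s , t))
    shape _ _ (yes u) (yes v) = flat (inj₂ (u , v))
    shape (no s) _ _ (no v) = crossed true (Cond3-corner-true s v)
    shape _ (no t) (no u) _ = crossed false (Cond3-corner-false t u)
    shape (yes s) (no t) (yes u) (no v) = nested (cond₁ ∘ Cond1-corner (s , t) (u , v))
    shape (no s) (yes t) (no u) (yes v) = nested (cond₂ ∘ Cond2-corner (t , s) (v , u))

module Diagonal {V U : Set} (P⁺ P⁻ : V → Pred V 0ℓ) (Q⁺ Q⁻ : U → Pred U 0ℓ)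
                (P⁺-refl : Reflexive P⁺) (P⁻-refl : Reflexive P⁻)
                (Q⁺-refl : Reflexive Q⁺) (Q⁻-refl : Reflexive Q⁻)
                {a a′ : V} {b b′ : U} (a≢a′ : a ≢ a′) (b≢b′ : b ≢ b′)
                (aa′⁺ : P⁺ a a′) (aa′⁻ : P⁻ a′ a) (bb′⁺ : Q⁺ b b′) (bb′⁻ : Q⁻ b′ b)
                (P-separates : ¬ ((P⁺ a ≐ P⁺ a′) × (P⁻ a ≐ P⁻ a′)))
                (Q-separates : ¬ ((Q⁺ b ≐ Q⁺ b′) × (Q⁻ b ≐ Q⁻ b′))) where

  open Square a a′ b b′
  module S⁺ = Side {P = P⁺} {Q⁺} P⁺-refl Q⁺-refl aa′⁺ P⁺-refl bb′⁺ Q⁺-refl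
  module S⁻ = Side {P = P⁻} {Q⁻} P⁻-refl Q⁻-refl P⁻-refl aa′⁻ Q⁻-refl bb′⁻

  Dispensableᴺ-diagonal : S⁺.Shape → S⁻.Shape → Dispensableᴺ (P⁺ ⊗ Q⁺) (P⁻ ⊗ Q⁻) (a , b) (a′ , b′)
  Dispensableᴺ-diagonal (S⁺.crossed c k⁺) (S⁻.crossed d k⁻) =
    disp₂ (corner c) (corner d) k⁺ (S⁻.WeakCond-corner c) k⁻ (S⁺.WeakCond-corner d)
  Dispensableᴺ-diagonal (S⁺.crossed c k⁺) (S⁻.nested f⁻) = disp₁ (corner c) (cond₃ k⁺) (f⁻ c)
  Dispensableᴺ-diagonal (S⁺.nested f⁺) (S⁻.crossed d k⁻) = disp₁ (corner d) (f⁺ d) (cond₃ k⁻)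
  Dispensableᴺ-diagonal (S⁺.nested f⁺) (S⁻.nested f⁻) = disp₁ (corner true) (f⁺ true) (f⁻ true)
  Dispensableᴺ-diagonal (S⁺.crossed c k⁺) (S⁻.flat e⁻) =
    disp₃ (corner c) (cond₃ k⁺) (S⁻.Flat⇒≐-corner e⁻ c)
  Dispensableᴺ-diagonal (S⁺.nested f⁺) (S⁻.flat e⁻) =
    disp₃ (corner true) (f⁺ true) (S⁻.Flat⇒≐-corner e⁻ true)
  Dispensableᴺ-diagonal (S⁺.flat e⁺) (S⁻.crossed d k⁻) =
    disp₄ (corner d) (cond₃ k⁻) (S⁺.Flat⇒≐-corner e⁺ d)
  Dispensableᴺ-diagonal (S⁺.flat e⁺) (S⁻.nested f⁻) =
    disp₄ (corner true) (f⁻ true) (S⁺.Flat⇒≐-corner e⁺ true)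
  Dispensableᴺ-diagonal (S⁺.flat (inj₁ e⁺)) (S⁻.flat (inj₁ e⁻)) = ⊥-elim (P-separates (e⁺ , e⁻))
  Dispensableᴺ-diagonal (S⁺.flat (inj₂ e⁺)) (S⁻.flat (inj₂ e⁻)) = ⊥-elim (Q-separates (e⁺ , e⁻))
  Dispensableᴺ-diagonal (S⁺.flat (inj₁ e⁺)) (S⁻.flat (inj₂ e⁻)) =
    disp₅ (corner false) (corner true)
      (a≢a′ ∘ sym ∘ cong proj₁) (a≢a′ ∘ sym ∘ cong proj₁) (b≢b′ ∘ cong proj₂)
      (b≢b′ ∘ sym ∘ cong proj₂) (a≢a′ ∘ cong proj₁)
      (proj₁ (S⁺.≐-corners₁ e⁺)) (proj₁ (S⁻.≐-corners₂ e⁻))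
      (proj₂ (S⁻.≐-corners₂ e⁻)) (proj₂ (S⁺.≐-corners₁ e⁺))
  Dispensableᴺ-diagonal (S⁺.flat (inj₂ e⁺)) (S⁻.flat (inj₁ e⁻)) =
    disp₅ (corner true) (corner false)
      (a≢a′ ∘ cong proj₁) (b≢b′ ∘ sym ∘ cong proj₂) (a≢a′ ∘ cong proj₁)
      (a≢a′ ∘ sym ∘ cong proj₁) (b≢b′ ∘ cong proj₂)
      (proj₁ (S⁺.≐-corners₂ e⁺)) (proj₁ (S⁻.≐-corners₁ e⁻))
      (proj₂ (S⁻.≐-corners₁ e⁻)) (proj₂ (S⁺.≐-corners₂ e⁺))

module _ {V : Set} (E : Rel V) where

  N⁺-refl : Reflexive (N⁺ E)
  N⁺-refl = inj₂ refl

  N⁻-refl : Reflexive (N⁻ E)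
  N⁻-refl = inj₂ refl

thin⇒distinguishing : {V : Set} {E : Rel V} → DecidableEquality V → Thin E →
                      Distinguishing (N⁺ E) (N⁻ E)
thin⇒distinguishing _≟_ thin {u} {u′} e⁺ e⁻ =
  decidable-stable (u ≟ u′) λ u≢u′ → thin u u′ u≢u′ (e⁺ , e⁻)

module _ {A B : Set} (EH : Rel A) (EK : Rel B) where

  N⁺-⊠ : ∀ w → N⁺ (EH ⊠ EK) w ≐ (N⁺ EH ⊗ N⁺ EK) w
  N⁺-⊠ (h , k) = split , join
    where
      split : N⁺ (EH ⊠ EK) (h , k) ⊆ (N⁺ EH ⊗ N⁺ EK) (h , k)
      split (inj₁ (inj₁ (e , refl)))        = inj₁ e , inj₂ refl
      split (inj₁ (inj₂ (inj₁ (f , refl)))) = inj₂ refl , inj₁ f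
      split (inj₁ (inj₂ (inj₂ (e , f))))    = inj₁ e , inj₁ f
      split (inj₂ refl)                     = inj₂ refl , inj₂ refl
      join : (N⁺ EH ⊗ N⁺ EK) (h , k) ⊆ N⁺ (EH ⊠ EK) (h , k)
      join (inj₁ e , inj₁ f)       = inj₁ (inj₂ (inj₂ (e , f)))
      join (inj₁ e , inj₂ refl)    = inj₁ (inj₁ (e , refl))
      join (inj₂ refl , inj₁ f)    = inj₁ (inj₂ (inj₁ (f , refl)))
      join (inj₂ refl , inj₂ refl) = inj₂ refl

  N⁻-⊠ : ∀ w → N⁻ (EH ⊠ EK) w ≐ (N⁻ EH ⊗ N⁻ EK) w
  N⁻-⊠ (h , k) = split , join
    where
      split : N⁻ (EH ⊠ EK) (h , k) ⊆ (N⁻ EH ⊗ N⁻ EK) (h , k)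
      split (inj₁ (inj₁ (e , refl)))        = inj₁ e , inj₂ refl
      split (inj₁ (inj₂ (inj₁ (f , refl)))) = inj₂ refl , inj₁ f
      split (inj₁ (inj₂ (inj₂ (e , f))))    = inj₁ e , inj₁ f
      split (inj₂ refl)                     = inj₂ refl , inj₂ refl
      join : (N⁻ EH ⊗ N⁻ EK) (h , k) ⊆ N⁻ (EH ⊠ EK) (h , k)
      join (inj₁ e , inj₁ f)       = inj₁ (inj₂ (inj₂ (e , f)))
      join (inj₁ e , inj₂ refl)    = inj₁ (inj₁ (e , refl))
      join (inj₂ refl , inj₁ f)    = inj₁ (inj₂ (inj₁ (f , refl)))
      join (inj₂ refl , inj₂ refl) = inj₂ refl

  Dispensable-⊠⇔ : ∀ {x y} →
    Dispensable (EH ⊠ EK) x y ⇔ Dispensableᴺ (N⁺ EH ⊗ N⁺ EK) (N⁻ EH ⊗ N⁻ EK) x y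
  Dispensable-⊠⇔ = mk⇔ (Dispensableᴺ-transport (≐-sym ∘ N⁺-⊠) (≐-sym ∘ N⁻-⊠))
                       (Dispensableᴺ-transport N⁺-⊠ N⁻-⊠)
    where open Relabelling id id (λ _ → refl)

edge-≢ : ∀ {n} (D : Digraph n) {a b} → _⇒_ D a b → a ≢ b
edge-≢ D e refl = loopless D _ e

N⁺-dec : ∀ {n} (D : Digraph n) v → Decidable (N⁺ (_⇒_ D) v)
N⁺-dec D v x = fromSum (decEdge D v x) ⊎-dec (x ≟ v)

N⁻-dec : ∀ {n} (D : Digraph n) v → Decidable (N⁻ (_⇒_ D) v)
N⁻-dec D v x = fromSum (decEdge D x v) ⊎-dec (x ≟ v)

⊆-dec : ∀ {n} {P Q : Pred (Fin n) 0ℓ} → Decidable P → Decidable Q → Dec (P ⊆ Q)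
⊆-dec P? Q? = map′ (λ P⇒Q {x} → P⇒Q x) (λ P⊆Q _ → P⊆Q) (all? λ x → P? x →-dec Q? x)

module _ {n m} (H : Digraph n) (K : Digraph m) where

  private
    EH : Rel (Fin n)
    EH = _⇒_ H
    EK : Rel (Fin m)
    EK = _⇒_ K
    module H×K = Axis (N⁺ EH) (N⁻ EH) (N⁺ EK) (N⁻ EK)
                      (N⁺-refl EH) (N⁻-refl EH) (N⁺-refl EK) (N⁻-refl EK)
    module K×H = Axis (N⁺ EK) (N⁻ EK) (N⁺ EH) (N⁻ EH)
                      (N⁺-refl EK) (N⁻-refl EK) (N⁺-refl EH) (N⁻-refl EH)

  Dispensable-⊠-horizontal : Thin EK → ∀ {h h′ k} →
    Dispensable (EH ⊠ EK) (h , k) (h′ , k) ⇔ Dispensable EH h h′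
  Dispensable-⊠-horizontal thinK = mk⇔
    (H×K.Dispensableᴺ-proj (thin⇒distinguishing _≟_ thinK) ∘ to (Dispensable-⊠⇔ EH EK))
    (from (Dispensable-⊠⇔ EH EK) ∘ H×K.Dispensableᴺ-lift)

  Dispensable-⊠-vertical : Thin EH → ∀ {h k k′} →
    Dispensable (EH ⊠ EK) (h , k) (h , k′) ⇔ Dispensable EK k k′
  Dispensable-⊠-vertical thinH = mk⇔
    (K×H.Dispensableᴺ-proj (thin⇒distinguishing _≟_ thinH)
      ∘ Dispensableᴺ-⊗-comm ∘ to (Dispensable-⊠⇔ EH EK))
    (from (Dispensable-⊠⇔ EH EK) ∘ Dispensableᴺ-⊗-comm ∘ K×H.Dispensableᴺ-lift)

  Dispensable-⊠-diagonal : Thin EH → Thin EK → ∀ {h h′ k k′} → EH h h′ → EK k k′ →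
    Dispensable (EH ⊠ EK) (h , k) (h′ , k′)
  Dispensable-⊠-diagonal thinH thinK {h} {h′} {k} {k′} e f =
    from (Dispensable-⊠⇔ EH EK) (Dispensableᴺ-diagonal
      (S⁺.shape (⊆? (N⁺-dec H) h h′) (⊆? (N⁺-dec H) h′ h) (⊆? (N⁺-dec K) k k′) (⊆? (N⁺-dec K) k′ k))
      (S⁻.shape (⊆? (N⁻-dec H) h h′) (⊆? (N⁻-dec H) h′ h) (⊆? (N⁻-dec K) k k′) (⊆? (N⁻-dec K) k′ k)))
    where
      open Diagonal (N⁺ EH) (N⁻ EH) (N⁺ EK) (N⁻ EK)
        (N⁺-refl EH) (N⁻-refl EH) (N⁺-refl EK) (N⁻-refl EK)
        (edge-≢ H e) (edge-≢ K f) (inj₁ e) (inj₁ e) (inj₁ f) (inj₁ f)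
        (thinH h h′ (edge-≢ H e)) (thinK k k′ (edge-≢ K f))
      ⊆? : ∀ {p} {N : Fin p → Pred (Fin p) 0ℓ} → (∀ v → Decidable (N v)) → ∀ a b → Dec (N a ⊆ N b)
      ⊆? N? a b = ⊆-dec (N? a) (N? b)

proposition13 : ∀ {n m} (H : Digraph n) (K : Digraph m) →
    Thin (_⇒_ H) → Thin (_⇒_ K) →
    Skel (_⇒_ H ⊠ _⇒_ K) ≅ᴱ (Skel (_⇒_ H) □ Skel (_⇒_ K))
proposition13 H K thinH thinK (h , k) (h′ , k′) = forward , backward
  where
    forward : Skel (_⇒_ H ⊠ _⇒_ K) (h , k) (h′ , k′) →
              (Skel (_⇒_ H) □ Skel (_⇒_ K)) (h , k) (h′ , k′)
    forward (inj₁ (e , refl) , kept) =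
      inj₁ ((e , kept ∘ from (Dispensable-⊠-horizontal H K thinK)) , refl)
    forward (inj₂ (inj₁ (f , refl)) , kept) =
      inj₂ ((f , kept ∘ from (Dispensable-⊠-vertical H K thinH)) , refl)
    forward (inj₂ (inj₂ (e , f)) , kept) =
      ⊥-elim (kept (Dispensable-⊠-diagonal H K thinH thinK e f))

    backward : (Skel (_⇒_ H) □ Skel (_⇒_ K)) (h , k) (h′ , k′) →
               Skel (_⇒_ H ⊠ _⇒_ K) (h , k) (h′ , k′)
    backward (inj₁ ((e , kept) , refl)) =
      inj₁ (e , refl) , kept ∘ to (Dispensable-⊠-horizontal H K thinK)
    backward (inj₂ ((f , kept) , refl)) =
      inj₂ (inj₁ (f , refl)) , kept ∘ to (Dispensable-⊠-vertical H K thinH)
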